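{- Let $F$ be a formula of propositional calculus in the variables $a_1,\dots,a_n$, let $N=2^n$, and define the parityformula $P_F=R_0(F)+R_1(F)+\dots+R_{N-1}(F)$, where $+$ is exclusive OR. Then $P_F$ is false under every truth assignment if and only if $F$ has an even number of satisfying truth assignments, and $P_F$ is true under every truth assignment if and only if $F$ has an odd number of satisfying truth assignments.
   Context: For $s\in\{0,\dots,N-1\}$ with binary representation $s=\sum_{r=1}^n2^{r-1}s_r$, $s_r\in\{0,1\}$, $R_s(F)$ denotes the formula obtained from $F$ by replacing each variable $a_r$ with $s_r=1$ by its negation $\sim a_r$ (and $\sim a_r$ by $a_r$); $R_0(F)=F$. -}

module Defs where

open import Data.Nat using (ℕ; zero; suc; _+_; _^_; _%_; _/_)
open import Data.Nat.Properties using ()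
open import Data.Bool using (Bool; true; false; not; _∧_; _∨_; _xor_; if_then_else_)
open import Data.Fin using (Fin; toℕ)
open import Data.Vec using (Vec; []; _∷_; lookup)
open import Data.List using (List; []; _∷_; map; _++_; foldr; length; filter; upTo)
open import Relation.Binary.PropositionalEquality using (_≡_)
open import Data.Nat.Properties using (_≟_)

-- Formulas of propositional calculus in the variables a_1 … a_n
-- (variable a_{r+1} is represented by  var r  with r : Fin n).
data Formula (n : ℕ) : Set where
  var  : Fin n → Formula n
  ⊤ᶠ ⊥ᶠ : Formula n
  ~_   : Formula n → Formula n
  _&_ _∣∣_ _⇒_ _⟺_ _⊕_ : Formula n → Formula n → Formula n

Assignment : ℕ → Set
Assignment n = Vec Bool n

eval : ∀ {n} → Assignment n → Formula n → Bool
eval v (var r) = lookup v r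
eval v ⊤ᶠ = true
eval v ⊥ᶠ = false
eval v (~ F) = not (eval v F)
eval v (F & G) = eval v F ∧ eval v G
eval v (F ∣∣ G) = eval v F ∨ eval v G
eval v (F ⇒ G) = not (eval v F) ∨ eval v G
eval v (F ⟺ G) = not (eval v F xor eval v G)
eval v (F ⊕ G) = eval v F xor eval v G

-- Binary digit s_r of s (r counted from 0, i.e. s_{r+1} in the paper)
bit : ℕ → ℕ → Bool
bit s zero with s % 2
... | zero = false
... | suc _ = true
bit s (suc r) = bit (s / 2) r

-- R_s(F): replace each variable a_r with s_r = 1 by its negation ~ a_r
-- (so ~ a_r becomes ~ ~ a_r, i.e. a_r semantically).
R : ∀ {n} → ℕ → Formula n → Formula n
R s (var r) = if bit s (toℕ r) then ~ var r else var r
R s ⊤ᶠ = ⊤ᶠ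
R s ⊥ᶠ = ⊥ᶠ
R s (~ F) = ~ R s F
R s (F & G) = R s F & R s G
R s (F ∣∣ G) = R s F ∣∣ R s G
R s (F ⇒ G) = R s F ⇒ R s G
R s (F ⟺ G) = R s F ⟺ R s G
R s (F ⊕ G) = R s F ⊕ R s G

xorAll : ∀ {n} → List (Formula n) → Formula n
xorAll [] = ⊥ᶠ
xorAll (F ∷ []) = F
xorAll (F ∷ Gs@(_ ∷ _)) = F ⊕ xorAll Gs

parityFormula : ∀ {n} → Formula n → Formula n
parityFormula {n} F = xorAll (map (λ s → R s F) (upTo (2 ^ n)))

allAssignments : (n : ℕ) → List (Assignment n)
allAssignments zero = [] ∷ []
allAssignments (suc n) =
  map (true ∷_) (allAssignments n) ++ map (false ∷_) (allAssignments n)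

numSat : ∀ {n} → Formula n → ℕ
numSat {n} F = length (filter (λ v → eval v F Data.Bool.≟ true) (allAssignments n))

Even Odd : ℕ → Set
Even k = k % 2 ≡ 0
Odd k = k % 2 ≡ 1

module Submission where

-- Write v^s for the assignment obtained from v by negating
-- the value of every variable a_r with s_r = 1.  Substituting negated
-- variables is the same as flipping the assignment, so
--     eval v (R_s F) = eval v^s F,   hence   eval v P_F = ⨁_{s < 2^n} eval v^s F.
-- For fixed v the map s ↦ v^s runs over all 2^n assignments, so the right
-- hand side is the XOR of the truth values of F over the whole cube, i.e. the
-- parity of the number of satisfying assignments.  In particular P_F is a
-- constant formula, with value "numSat F is odd", and both equivalences follow.

open import Defs
open import Data.Nat using (ℕ; zero; suc; _+_; _*_; _^_; _%_; _/_)
open import Data.Nat.Properties using (*-comm)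
open import Data.Nat.DivMod using ([m+kn]%n≡m%n; +-distrib-/-∣ʳ; m*n/n≡m)
open import Data.Nat.Divisibility using (n∣m*n)
open import Data.Bool using (Bool; true; false; not; _∧_; _∨_; _xor_; _≟_)
open import Data.Bool.Properties
  using (not-involutive; xor-assoc; xor-comm; xor-identityʳ; xor-∧-commutativeRing)
open import Algebra.Bundles using (CommutativeRing)
open import Algebra.Properties.CommutativeSemigroup
  (CommutativeRing.+-commutativeSemigroup xor-∧-commutativeRing) using (interchange)
open import Data.Fin using (toℕ) renaming (zero to fzero; suc to fsuc)
open import Data.Vec using ([]; _∷_; lookup; replicate)
open import Data.List using (List; []; _∷_; map; _++_; foldr; length; filter; upTo; applyUpTo)
open import Data.List.Properties using (map-++; map-∘; map-upTo)
open import Data.Product using (_×_; _,_)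
open import Function using (_∘_)
open import Function.Bundles using (_⇔_; mk⇔)
open import Relation.Binary.PropositionalEquality
  using (_≡_; _≗_; refl; sym; trans; cong; cong₂; module ≡-Reasoning)

open ≡-Reasoning

⨁ : List Bool → Bool
⨁ = foldr _xor_ false

⨁-++ : ∀ xs ys → ⨁ (xs ++ ys) ≡ ⨁ xs xor ⨁ ys
⨁-++ []       ys = refl
⨁-++ (x ∷ xs) ys = trans (cong (x xor_) (⨁-++ xs ys)) (sym (xor-assoc x (⨁ xs) (⨁ ys)))

applyUpTo-cong : ∀ {A : Set} {g h : ℕ → A} → g ≗ h → ∀ m → applyUpTo g m ≡ applyUpTo h m
applyUpTo-cong g≗h zero    = refl
applyUpTo-cong g≗h (suc m) = cong₂ _∷_ (g≗h 0) (applyUpTo-cong (g≗h ∘ suc) m)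

⨁-pairs : ∀ (g : ℕ → Bool) m →
  ⨁ (applyUpTo g (m * 2)) ≡ ⨁ (applyUpTo (λ k → g (k * 2) xor g (1 + k * 2)) m)
⨁-pairs g zero    = refl
⨁-pairs g (suc m) =
  trans (sym (xor-assoc (g 0) (g 1) _)) (cong ((g 0 xor g 1) xor_) (⨁-pairs (g ∘ suc ∘ suc) m))

⨁-xor : ∀ (g h : ℕ → Bool) m →
  ⨁ (applyUpTo (λ k → g k xor h k) m) ≡ ⨁ (applyUpTo g m) xor ⨁ (applyUpTo h m)
⨁-xor g h zero    = refl
⨁-xor g h (suc m) =
  trans (cong ((g 0 xor h 0) xor_) (⨁-xor (g ∘ suc) (h ∘ suc) m)) (interchange (g 0) (h 0) _ _)

digit : Bool → ℕ
digit false = 0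
digit true  = 1

isOdd : ℕ → Bool
isOdd zero    = false
isOdd (suc m) = not (isOdd m)

%2-isOdd : ∀ m → m % 2 ≡ digit (isOdd m)
%2-isOdd zero          = refl
%2-isOdd (suc zero)    = refl
%2-isOdd (suc (suc m)) = trans (%2-isOdd m) (cong digit (sym (not-involutive (isOdd m))))

digit-injective : ∀ {b c} → digit b ≡ digit c → b ≡ c
digit-injective {false} {false} _ = refl
digit-injective {true}  {true}  _ = refl

⨁-count : ∀ {A : Set} (p : A → Bool) xs →
  ⨁ (map p xs) ≡ isOdd (length (filter (λ x → p x ≟ true) xs))
⨁-count p []       = refl
⨁-count p (x ∷ xs) with p x
... | true  = cong not (⨁-count p xs)
... | false = ⨁-count p xs

-- In bit-low the
-- remaining cases are refuted by the equation (b + 2k) % 2 ≡ b % 2.  These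
-- two facts let us split the indices s < 2^(n+1) according to their lowest bit.
bit-low : ∀ b k → bit (digit b + k * 2) 0 ≡ b
bit-low b k with (digit b + k * 2) % 2 | [m+kn]%n≡m%n (digit b) k 2
bit-low false k | zero | _ = refl
bit-low true  k | suc _ | _ = refl

halve : ∀ b k → (digit b + k * 2) / 2 ≡ k
halve false k = m*n/n≡m k 2
halve true  k = trans (+-distrib-/-∣ʳ 1 {d = 2} (n∣m*n k)) (m*n/n≡m k 2)

-- flipBy v s negates the value of variable r in v exactly when bit s r = true,
-- the semantic counterpart of the syntactic substitution R s.
flipBy : ∀ {n} → Assignment n → ℕ → Assignment n
flipBy []      s = []
flipBy (b ∷ v) s = (b xor bit s 0) ∷ flipBy v (s / 2)

lookup-flipBy : ∀ {n} (v : Assignment n) s r →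
  lookup (flipBy v s) r ≡ lookup v r xor bit s (toℕ r)
lookup-flipBy (b ∷ v) s fzero    = refl
lookup-flipBy (b ∷ v) s (fsuc r) = lookup-flipBy v (s / 2) r

eval-R : ∀ {n} (v : Assignment n) s F → eval v (R s F) ≡ eval (flipBy v s) F
eval-R v s (var r) rewrite lookup-flipBy v s r with bit s (toℕ r)
... | true  = sym (xor-comm (lookup v r) true)
... | false = sym (xor-identityʳ (lookup v r))
eval-R v s ⊤ᶠ       = refl
eval-R v s ⊥ᶠ       = refl
eval-R v s (~ F)    = cong not (eval-R v s F)
eval-R v s (F & G)  = cong₂ _∧_ (eval-R v s F) (eval-R v s G)
eval-R v s (F ∣∣ G) = cong₂ _∨_ (eval-R v s F) (eval-R v s G)
eval-R v s (F ⇒ G)  = cong₂ (λ x y → not x ∨ y) (eval-R v s F) (eval-R v s G)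
eval-R v s (F ⟺ G)  = cong₂ (λ x y → not (x xor y)) (eval-R v s F) (eval-R v s G)
eval-R v s (F ⊕ G)  = cong₂ _xor_ (eval-R v s F) (eval-R v s G)

flipBy-∷ : ∀ {n} c (v : Assignment n) b k →
  flipBy (c ∷ v) (digit b + k * 2) ≡ (c xor b) ∷ flipBy v k
flipBy-∷ c v b k = cong₂ _∷_ (cong (c xor_) (bit-low b k)) (cong (flipBy v) (halve b k))

xor-both-values : ∀ (h : Bool → Bool) c → h (c xor false) xor h (c xor true) ≡ h true xor h false
xor-both-values h false = xor-comm (h false) (h true)
xor-both-values h true  = refl

⨁-allAssignments : ∀ n (f : Assignment (suc n) → Bool) →
  ⨁ (map f (allAssignments (suc n)))
    ≡ ⨁ (map (f ∘ (true ∷_)) (allAssignments n)) xor ⨁ (map (f ∘ (false ∷_)) (allAssignments n))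
⨁-allAssignments n f = begin
  ⨁ (map f (map (true ∷_) A ++ map (false ∷_) A))
    ≡⟨ cong ⨁ (map-++ f (map (true ∷_) A) (map (false ∷_) A)) ⟩
  ⨁ (map f (map (true ∷_) A) ++ map f (map (false ∷_) A))
    ≡⟨ ⨁-++ (map f (map (true ∷_) A)) (map f (map (false ∷_) A)) ⟩
  ⨁ (map f (map (true ∷_) A)) xor ⨁ (map f (map (false ∷_) A))
    ≡⟨ sym (cong₂ (λ xs ys → ⨁ xs xor ⨁ ys) (map-∘ A) (map-∘ A)) ⟩
  ⨁ (map (f ∘ (true ∷_)) A) xor ⨁ (map (f ∘ (false ∷_)) A) ∎
  where A = allAssignments n

-- Key lemma: for any fixed v, the flips  flipBy v s  (s < 2^n) run over the
-- whole cube, so XOR-ing any f over them is XOR-ing f over all assignments.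
⨁-flips : ∀ n (v : Assignment n) (f : Assignment n → Bool) →
  ⨁ (applyUpTo (f ∘ flipBy v) (2 ^ n)) ≡ ⨁ (map f (allAssignments n))
⨁-flips zero    []      f = refl
⨁-flips (suc n) (c ∷ v) f = begin
  ⨁ (applyUpTo (f ∘ flipBy (c ∷ v)) (2 * 2 ^ n))
    ≡⟨ cong (⨁ ∘ applyUpTo (f ∘ flipBy (c ∷ v))) (*-comm 2 (2 ^ n)) ⟩
  ⨁ (applyUpTo (f ∘ flipBy (c ∷ v)) (2 ^ n * 2))
    ≡⟨ ⨁-pairs (f ∘ flipBy (c ∷ v)) (2 ^ n) ⟩
  ⨁ (applyUpTo (λ k → f (flipBy (c ∷ v) (k * 2)) xor f (flipBy (c ∷ v) (1 + k * 2))) (2 ^ n))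
    ≡⟨ cong ⨁ (applyUpTo-cong (λ k → cong₂ (λ x y → f x xor f y)
                 (flipBy-∷ c v false k) (flipBy-∷ c v true k)) (2 ^ n)) ⟩
  ⨁ (applyUpTo (λ k → f ((c xor false) ∷ flipBy v k) xor f ((c xor true) ∷ flipBy v k)) (2 ^ n))
    ≡⟨ cong ⨁ (applyUpTo-cong (λ k → xor-both-values (λ b → f (b ∷ flipBy v k)) c) (2 ^ n)) ⟩
  ⨁ (applyUpTo (λ k → f (true ∷ flipBy v k) xor f (false ∷ flipBy v k)) (2 ^ n))
    ≡⟨ ⨁-xor (λ k → f (true ∷ flipBy v k)) (λ k → f (false ∷ flipBy v k)) (2 ^ n) ⟩
  ⨁ (applyUpTo (λ k → f (true ∷ flipBy v k)) (2 ^ n))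
    xor ⨁ (applyUpTo (λ k → f (false ∷ flipBy v k)) (2 ^ n))
    ≡⟨ cong₂ _xor_ (⨁-flips n v (f ∘ (true ∷_))) (⨁-flips n v (f ∘ (false ∷_))) ⟩
  ⨁ (map (f ∘ (true ∷_)) (allAssignments n)) xor ⨁ (map (f ∘ (false ∷_)) (allAssignments n))
    ≡⟨ sym (⨁-allAssignments n f) ⟩
  ⨁ (map f (allAssignments (suc n))) ∎

eval-xorAll : ∀ {n} (v : Assignment n) Fs → eval v (xorAll Fs) ≡ ⨁ (map (eval v) Fs)
eval-xorAll v []              = refl
eval-xorAll v (F ∷ [])        = sym (xor-identityʳ (eval v F))
eval-xorAll v (F ∷ Gs@(_ ∷ _)) = cong (eval v F xor_) (eval-xorAll v Gs)

eval-parityFormula : ∀ n (F : Formula n) (v : Assignment n) →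
  eval v (parityFormula F) ≡ isOdd (numSat F)
eval-parityFormula n F v = begin
  eval v (xorAll (map (λ s → R s F) (upTo (2 ^ n))))
    ≡⟨ eval-xorAll v (map (λ s → R s F) (upTo (2 ^ n))) ⟩
  ⨁ (map (eval v) (map (λ s → R s F) (upTo (2 ^ n))))
    ≡⟨ cong ⨁ (sym (map-∘ (upTo (2 ^ n)))) ⟩
  ⨁ (map (λ s → eval v (R s F)) (upTo (2 ^ n)))
    ≡⟨ cong ⨁ (map-upTo (λ s → eval v (R s F)) (2 ^ n)) ⟩
  ⨁ (applyUpTo (λ s → eval v (R s F)) (2 ^ n))
    ≡⟨ cong ⨁ (applyUpTo-cong (λ s → eval-R v s F) (2 ^ n)) ⟩
  ⨁ (applyUpTo (λ s → eval (flipBy v s) F) (2 ^ n))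
    ≡⟨ ⨁-flips n v (λ w → eval w F) ⟩
  ⨁ (map (λ w → eval w F) (allAssignments n))
    ≡⟨ ⨁-count (λ w → eval w F) (allAssignments n) ⟩
  isOdd (numSat F) ∎

-- Hence P_F is constantly b exactly when numSat F ≡ b (mod 2).  The forward
-- direction evaluates P_F at one assignment (there always is one, even for n = 0).
parityFormula-constant : ∀ n (F : Formula n) b →
  ((v : Assignment n) → eval v (parityFormula F) ≡ b) ⇔ numSat F % 2 ≡ digit b
parityFormula-constant n F b = mk⇔ constant⇒parity parity⇒constant
  where
  constant⇒parity : ((v : Assignment n) → eval v (parityFormula F) ≡ b) → numSat F % 2 ≡ digit b
  constant⇒parity const = begin
    numSat F % 2                                        ≡⟨ %2-isOdd (numSat F) ⟩
    digit (isOdd (numSat F))                            ≡⟨ cong digit (sym (eval-parityFormula n F v₀)) ⟩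
    digit (eval v₀ (parityFormula F))                   ≡⟨ cong digit (const v₀) ⟩
    digit b                                             ∎
    where v₀ = replicate n false

  parity⇒constant : numSat F % 2 ≡ digit b → (v : Assignment n) → eval v (parityFormula F) ≡ b
  parity⇒constant parity v =
    trans (eval-parityFormula n F v) (digit-injective (trans (sym (%2-isOdd (numSat F))) parity))

mainTheorem8 : (n : ℕ) (F : Formula n) →
    (((v : Assignment n) → eval v (parityFormula F) ≡ false) ⇔ Even (numSat F))
    × (((v : Assignment n) → eval v (parityFormula F) ≡ true) ⇔ Odd (numSat F))
mainTheorem8 n F = parityFormula-constant n F false , parityFormula-constant n F true
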